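{- Let $\mathbb{K}$ be a field with $\mathrm{char}(\mathbb{K})\neq 2$, let $X^2+a_1X+a_2$ be an irreducible polynomial over $\mathbb{K}$, let $\alpha$ be a root of it and $\mathbb{L}=\mathbb{K}(\alpha)$. Then for $\beta\in\mathbb{L}$: $\beta\in T_0T_0$ if and only if $\beta\in\mathbb{K}$.
   Context: $\mathrm{Tr}=\mathrm{Tr}_{\mathbb{L}/\mathbb{K}}$ is the field trace ($\mathrm{Tr}(\gamma)$ is the trace of the $\mathbb{K}$-linear map $x\mapsto\gamma x$ on $\mathbb{L}$). For $c\in\mathbb{K}$, $T_c=\{x\in\mathbb{L}\mid\mathrm{Tr}(x)=c\}$, and $T_cT_e=\{xy\mid x\in T_c,\ y\in T_e\}$. -}

module Defs where

open import Level using (Level; _⊔_)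
open import Algebra.Bundles using (CommutativeRing)
open import Data.Product using (Σ; ∃; ∃-syntax; _×_; _,_; proj₁; proj₂)
open import Relation.Nullary using (¬_)

module _ {c ℓ : Level} (K : CommutativeRing c ℓ) where
  open CommutativeRing K

  IsField : Set (c ⊔ ℓ)
  IsField = (¬ (0# ≈ 1#)) × (∀ x → ¬ (x ≈ 0#) → ∃[ y ] (x * y ≈ 1#))

  CharNot2 : Set ℓ
  CharNot2 = ¬ ((1# + 1#) ≈ 0#)

  -- The monic quadratic X² + a₁X + a₂ is irreducible over K: it is not a
  -- product of two non-unit polynomials, i.e. (degrees forced to be 1, normalised
  -- to be monic) there are no b, c with X² + a₁X + a₂ = (X + b)(X + c),
  -- written out by comparing coefficients.
  IrreducibleQuadratic : Carrier → Carrier → Set (c ⊔ ℓ)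
  IrreducibleQuadratic a₁ a₂ =
    ¬ (∃[ b ] ∃[ d ] (((b + d) ≈ a₁) × ((b * d) ≈ a₂)))

-- The extension L = K(α), α a root of X² + a₁X + a₂ (irreducible), realised as
-- K[X]/(X² + a₁X + a₂): elements are pairs (x , y) standing for x + yα,
-- with α² = - a₁ α - a₂.
module Quadratic {c ℓ : Level} (K : CommutativeRing c ℓ) (a₁ a₂ : CommutativeRing.Carrier K) where
  open CommutativeRing K

  L : Set c
  L = Carrier × Carrier

  _≈L_ : L → L → Set ℓ
  (x , y) ≈L (x' , y') = (x ≈ x') × (y ≈ y')

  ι : Carrier → L
  ι k = (k , 0#)

  oneL : L
  oneL = (1# , 0#)

  α : L
  α = (0# , 1#)

  -- (x + yα)(x' + y'α) = xx' + (xy' + yx')α + yy'α²,  α² = -a₂ - a₁α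
  _*L_ : L → L → L
  (x , y) *L (x' , y') =
    ( (x * x') + (- (a₂ * (y * y')))
    , ((x * y') + (y * x')) + (- (a₁ * (y * y'))) )

  -- Tr_{L/K}(γ) = trace of the K-linear map z ↦ γ z in the basis (1, α):
  -- the 1-coordinate of γ·1 plus the α-coordinate of γ·α.
  Tr : L → Carrier
  Tr γ = proj₁ (γ *L oneL) + proj₂ (γ *L α)

  InT : Carrier → L → Set ℓ
  InT t x = Tr x ≈ t

  InTT : Carrier → Carrier → L → Set (c ⊔ ℓ)
  InTT t e β = ∃[ x ] ∃[ y ] (InT t x × InT e y × (β ≈L (x *L y)))

  InK : L → Set (c ⊔ ℓ)
  InK β = ∃[ k ] (β ≈L ι k)

-- Writing elements of L as x + yα, the trace is Tr(x + yα) = 2x − a₁y. For two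
-- traceless elements u, v the α-coordinate z of uv satisfies
-- 2z = y_v·Tr u + y_u·Tr v = 0, so uv ∈ K once 2 is invertible. Conversely the
-- traceless line is spanned by δ = a₁ + 2α, and δ² = a₁² − 4a₂ is the
-- discriminant Δ, which is nonzero because otherwise −a₁/2 would be a double
-- root; hence k = δ · (k/Δ)δ for every k ∈ K.
module Submission where

open import Defs
open import Algebra.Bundles using (CommutativeRing)
open import Data.Product using (∃-syntax; _,_; proj₁; proj₂)
open import Function.Bundles using (_⇔_; mk⇔)
open import Level using (Level)
open import Relation.Nullary using (¬_)
import Algebra.Properties.Group as GroupProperties
import Algebra.Properties.Ring as RingProperties
import Algebra.Solver.Ring.NaturalCoefficients.Default as NaturalCoefficients
import Relation.Binary.Reasoning.Setoid as SetoidReasoning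

module Doubling {c ℓ : Level} (K : CommutativeRing c ℓ) where
  open CommutativeRing K
  open NaturalCoefficients commutativeSemiring
  open SetoidReasoning setoid

  two : Carrier
  two = 1# + 1#

  double≈0⇒≈0 : ∀ {h z} → two * h ≈ 1# → z + z ≈ 0# → z ≈ 0#
  double≈0⇒≈0 {h} {z} 2h≈1 z+z≈0 = begin
    z             ≈⟨ sym (*-identityˡ z) ⟩
    1# * z        ≈⟨ *-congʳ (sym 2h≈1) ⟩
    (two * h) * z ≈⟨ solve 2 (λ h z → (con 2 :* h) :* z := h :* (z :+ z)) refl h z ⟩
    h * (z + z)   ≈⟨ *-congˡ z+z≈0 ⟩
    h * 0#        ≈⟨ zeroʳ h ⟩
    0#            ∎

module QuadraticExtension {c ℓ : Level} (K : CommutativeRing c ℓ) (a₁ a₂ : CommutativeRing.Carrier K) where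
  open CommutativeRing K
  open Quadratic K a₁ a₂
  open Doubling K public
  open GroupProperties +-group using (x∙y⁻¹≈ε⇒x≈y)
  open RingProperties ring using (-‿distribˡ-*)
  open NaturalCoefficients commutativeSemiring
  open SetoidReasoning setoid

  -- Negations moved onto the coefficients, so that the identities below are
  -- semiring identities in the atoms − a₁ and − a₂ (the solver has no negation).
  *L-expand : ∀ x y x' y' → ((x , y) *L (x' , y')) ≈L
    (x * x' + (- a₂) * (y * y') , (x * y' + y * x') + (- a₁) * (y * y'))
  *L-expand x y x' y' = +-congˡ (-‿distribˡ-* a₂ _) , +-congˡ (-‿distribˡ-* a₁ _)

  Tr-expand : ∀ x y → Tr (x , y) ≈ (x + x) + (- a₁) * y
  Tr-expand x y = begin
    Tr (x , y)
      ≈⟨ +-cong (proj₁ (*L-expand x y 1# 0#)) (proj₂ (*L-expand x y 0# 1#)) ⟩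
    (x * 1# + (- a₂) * (y * 0#)) + ((x * 1# + y * 0#) + (- a₁) * (y * 1#))
      ≈⟨ solve 4 (λ x y m₁ m₂ → (x :* con 1 :+ m₂ :* (y :* con 0)) :+ ((x :* con 1 :+ y :* con 0) :+ m₁ :* (y :* con 1))
                              := (x :+ x) :+ m₁ :* y) refl x y (- a₁) (- a₂) ⟩
    (x + x) + (- a₁) * y
      ∎

  double-proj₂-*L : ∀ x y x' y' → let z = proj₂ ((x , y) *L (x' , y')) in
    z + z ≈ y' * Tr (x , y) + y * Tr (x' , y')
  double-proj₂-*L x y x' y' = begin
    _ ≈⟨ +-cong (proj₂ (*L-expand x y x' y')) (proj₂ (*L-expand x y x' y')) ⟩
    ((x * y' + y * x') + (- a₁) * (y * y')) + ((x * y' + y * x') + (- a₁) * (y * y'))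
      ≈⟨ solve 5 (λ x y x' y' m → ((x :* y' :+ y :* x') :+ m :* (y :* y')) :+ ((x :* y' :+ y :* x') :+ m :* (y :* y'))
                               := y' :* ((x :+ x) :+ m :* y) :+ y :* ((x' :+ x') :+ m :* y')) refl x y x' y' (- a₁) ⟩
    y' * ((x + x) + (- a₁) * y) + y * ((x' + x') + (- a₁) * y')
      ≈⟨ +-cong (*-congˡ (sym (Tr-expand x y))) (*-congˡ (sym (Tr-expand x' y'))) ⟩
    y' * Tr (x , y) + y * Tr (x' , y')
      ∎

  T₀T₀⊆K : ∀ {h} → two * h ≈ 1# → ∀ β → InTT 0# 0# β → InK β
  T₀T₀⊆K 2h≈1 β (u@(x , y) , v@(x' , y') , Tr-u≈0 , Tr-v≈0 , β≈u*v) =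
    proj₁ (u *L v) , proj₁ β≈u*v , trans (proj₂ β≈u*v) (double≈0⇒≈0 2h≈1 double-z≈0)
    where
    double-z≈0 : proj₂ (u *L v) + proj₂ (u *L v) ≈ 0#
    double-z≈0 = begin
      proj₂ (u *L v) + proj₂ (u *L v) ≈⟨ double-proj₂-*L x y x' y' ⟩
      y' * Tr u + y * Tr v            ≈⟨ +-cong (*-congˡ Tr-u≈0) (*-congˡ Tr-v≈0) ⟩
      y' * 0# + y * 0#                ≈⟨ +-cong (zeroʳ y') (zeroʳ y) ⟩
      0# + 0#                         ≈⟨ +-identityʳ 0# ⟩
      0#                              ∎

  discriminant : Carrier
  discriminant = a₁ * a₁ + (- a₂) * (two * two)

  δ : Carrier → L
  δ o = (a₁ * o , two * o)

  Tr-δ : ∀ o → Tr (δ o) ≈ 0#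
  Tr-δ o = begin
    Tr (δ o)                          ≈⟨ Tr-expand (a₁ * o) (two * o) ⟩
    (a₁ * o + a₁ * o) + (- a₁) * (two * o)
      ≈⟨ solve 3 (λ a m o → (a :* o :+ a :* o) :+ m :* (con 2 :* o) := (a :+ m) :* (con 2 :* o)) refl a₁ (- a₁) o ⟩
    (a₁ + - a₁) * (two * o)           ≈⟨ *-congʳ (-‿inverseʳ a₁) ⟩
    0# * (two * o)                    ≈⟨ zeroˡ _ ⟩
    0#                                ∎

  δ-*L-δ : ∀ o o' → (δ o *L δ o') ≈L ι (discriminant * (o * o'))
  δ-*L-δ o o' = trans (proj₁ (*L-expand _ _ _ _)) first , trans (proj₂ (*L-expand _ _ _ _)) second
    where
    first : (a₁ * o) * (a₁ * o') + (- a₂) * ((two * o) * (two * o')) ≈ discriminant * (o * o')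
    first = solve 4 (λ a m o o' → (a :* o) :* (a :* o') :+ m :* ((con 2 :* o) :* (con 2 :* o'))
                               := (a :* a :+ m :* (con 2 :* con 2)) :* (o :* o')) refl a₁ (- a₂) o o'
    second : ((a₁ * o) * (two * o') + (two * o) * (a₁ * o')) + (- a₁) * ((two * o) * (two * o')) ≈ 0#
    second = begin
      _ ≈⟨ solve 4 (λ a m o o' → ((a :* o) :* (con 2 :* o') :+ (con 2 :* o) :* (a :* o')) :+ m :* ((con 2 :* o) :* (con 2 :* o'))
                              := (a :+ m) :* ((con 2 :* con 2) :* (o :* o'))) refl a₁ (- a₁) o o' ⟩
      (a₁ + - a₁) * ((two * two) * (o * o')) ≈⟨ *-congʳ (-‿inverseʳ a₁) ⟩
      0# * ((two * two) * (o * o'))           ≈⟨ zeroˡ _ ⟩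
      0#                                      ∎

  K⊆T₀T₀ : ∀ {w} → discriminant * w ≈ 1# → ∀ β → InK β → InTT 0# 0# β
  K⊆T₀T₀ {w} Δw≈1 β (k , β≈k) =
    δ 1# , δ (w * k) , Tr-δ 1# , Tr-δ (w * k) ,
    trans (proj₁ β≈k) (sym (trans (proj₁ (δ-*L-δ 1# (w * k))) Δ[1wk]≈k)) ,
    trans (proj₂ β≈k) (sym (proj₂ (δ-*L-δ 1# (w * k))))
    where
    Δ[1wk]≈k : discriminant * (1# * (w * k)) ≈ k
    Δ[1wk]≈k = begin
      discriminant * (1# * (w * k)) ≈⟨ *-congˡ (*-identityˡ _) ⟩
      discriminant * (w * k)        ≈⟨ sym (*-assoc _ w k) ⟩
      (discriminant * w) * k        ≈⟨ *-congʳ Δw≈1 ⟩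
      1# * k                        ≈⟨ *-identityˡ k ⟩
      k                             ∎

  discriminant≉0 : IrreducibleQuadratic K a₁ a₂ → ∀ {h} → two * h ≈ 1# → ¬ discriminant ≈ 0#
  discriminant≉0 irreducible {h} 2h≈1 Δ≈0 = irreducible (a₁ * h , a₁ * h , sum , product)
    where
    sum : a₁ * h + a₁ * h ≈ a₁
    sum = begin
      a₁ * h + a₁ * h ≈⟨ solve 2 (λ a h → a :* h :+ a :* h := a :* (con 2 :* h)) refl a₁ h ⟩
      a₁ * (two * h)  ≈⟨ *-congˡ 2h≈1 ⟩
      a₁ * 1#         ≈⟨ *-identityʳ a₁ ⟩
      a₁              ∎
    product : (a₁ * h) * (a₁ * h) ≈ a₂
    product = x∙y⁻¹≈ε⇒x≈y _ _ (begin
      (a₁ * h) * (a₁ * h) + - a₂                              ≈⟨ +-congˡ (sym (*-identityʳ _)) ⟩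
      (a₁ * h) * (a₁ * h) + (- a₂) * 1#                       ≈⟨ +-congˡ (*-congˡ (sym (trans (*-cong 2h≈1 2h≈1) (*-identityʳ 1#)))) ⟩
      (a₁ * h) * (a₁ * h) + (- a₂) * ((two * h) * (two * h))
        ≈⟨ solve 3 (λ a m h → (a :* h) :* (a :* h) :+ m :* ((con 2 :* h) :* (con 2 :* h))
                            := (a :* a :+ m :* (con 2 :* con 2)) :* (h :* h)) refl a₁ (- a₂) h ⟩
      discriminant * (h * h)                                  ≈⟨ *-congʳ Δ≈0 ⟩
      0# * (h * h)                                            ≈⟨ zeroˡ _ ⟩
      0#                                                      ∎)

proposition2p2 : ∀ {c ℓ} (K : CommutativeRing c ℓ) → IsField K → CharNot2 K →
    (a₁ a₂ : CommutativeRing.Carrier K) → IrreducibleQuadratic K a₁ a₂ →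
    (β : Quadratic.L K a₁ a₂) →
    Quadratic.InTT K a₁ a₂ (CommutativeRing.0# K) (CommutativeRing.0# K) β ⇔ Quadratic.InK K a₁ a₂ β
proposition2p2 K (_ , inverse) 2≉0 a₁ a₂ irreducible β =
  mk⇔ (T₀T₀⊆K (proj₂ 2⁻¹) β) (K⊆T₀T₀ (proj₂ Δ⁻¹) β)
  where
  open CommutativeRing K
  open QuadraticExtension K a₁ a₂
  2⁻¹ : ∃[ h ] two * h ≈ 1#
  2⁻¹ = inverse two 2≉0
  Δ⁻¹ : ∃[ w ] discriminant * w ≈ 1#
  Δ⁻¹ = inverse discriminant (discriminant≉0 irreducible (proj₂ 2⁻¹))
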